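{- Let $\mathsf{L}$ be a relevant modal logic (determined by a set $\Phi$ of frame conditions from the table below) such that the rule (Nec) (from $\varphi$ infer $\Box\varphi$) is not an inference rule of the axiom system $\mathsf{L}$. Then for every formula $\varphi$: (1) if $\varphi$ is provable in $\mathsf{L}$, then $\varphi$ is provable in $\mathsf{CL}$; (2) if $\Box_L\varphi$ is provable in $\mathsf{CL}$, then $\varphi$ is provable in $\mathsf{CL}$.
   Context: Language: a countable set $Pr$ of propositional variables, binary connectives $\land,\lor,\to$ and unary connectives $\neg,\Box,\Box_L$; $\varphi\leftrightarrow\psi:=(\varphi\to\psi)\land(\psi\to\varphi)$. Frame conditions and corresponding axioms/rules (conditions on a ternary $R$, binary $Q$, unary $*$, order $\le$, distinguished set $L$; $Rstuv:=\exists x(Rstx\,\&\,Rxuv)$, $Rs(tu)v:=\exists x(Rtux\,\&\,Rsxv)$, $RQstu:=\exists x(Rstx\,\&\,Qxu)$, $QRstu:=\exists x(Qsx\,\&\,Rxtu)$): (DN) $s^{**}=s$ / $p\leftrightarrow\neg\neg p$; (Cp) $Rstu\Rightarrow Rsu^*t^*$ / $(p\to q)\to(\neg q\to\neg p)$; (WB) $Rstu\Rightarrow Rs(st)u$ / $((p\to q)\land(q\to r))\to(p\to r)$; (X) $s\in L\Rightarrow s^*\le s$ / $p\lor\neg p$; (Rd) $Rss^*s$ / $(p\to\neg p)\to\neg p$; (B) $Rstuv\Rightarrow Rs(tu)v$ / $(p\to q)\to((r\to p)\to(r\to q))$; (CB) $Rstuv\Rightarrow Rt(su)v$ / $(p\to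 q)\to((q\to r)\to(p\to r))$; (W) $Rstu\Rightarrow Rsttu$ / $(p\to(p\to q))\to(p\to q)$; (C) $Rstuv\Rightarrow Rsutv$ / $(p\to(q\to r))\to(q\to(p\to r))$; (M) $Rstu\Rightarrow(s\le u$ or $t\le u)$ / $p\to(p\to p)$; (ER) $\exists x(x\in L\,\&\,Rsxs)$ / rule: from $\varphi$ infer $(\varphi\to\psi)\to\psi$; (Nec) $(x\in L\,\&\,Qxs)\Rightarrow s\in L$ / rule: from $\varphi$ infer $\Box\varphi$; ($\Box$K) $RQstu\Rightarrow\exists x(Qtx\,\&\,QRsxu)$ / $\Box(p\to q)\to(\Box p\to\Box q)$; ($\Box$T) $Qss$ / $\Box p\to p$; ($\Box$D) $\exists x(Qsx^*\,\&\,Qs^*x)$ / $\Box\neg p\to\neg\Box p$; ($\Box$4) $(Qst\,\&\,Qtu)\Rightarrow Qsu$ / $\Box p\to\Box\Box p$; ($\Box$5) $(Qs^*u\,\&\,Qst)\Rightarrow Qt^*u$ / $\neg\Box p\to\Box\neg\Box p$. The axiom system $\mathsf{L}$ is $\mathsf{BM.C}$ plus the axioms/rules corresponding to the chosen set $\Phi$, where $\mathsf{BM.C}$ has axioms $p\to p$; $\neg(p\land q)\to(\neg p\lor\neg q)$; $(\neg p\land\neg q)\to\neg(p\lor q)$; $(p\land q)\to p$; $(p\land q)\to q$; $p\to(p\lor q)$; $q\to(p\lor q)$; $((p\to q)\land(p\to r))\to(p\to(q\land r))$; $((p\to r)\land(q\to r))\to((p\lor q)\to r)$; $(p\land(q\lor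 r))\to((p\land q)\lor(p\land r))$; $(\Box p\land\Box q)\to\Box(p\land q)$; $(\Box_Lp\land\Box_Lq)\to\Box_L(p\land q)$; rules: uniform substitution, modus ponens, adjunction ($\varphi,\psi/\varphi\land\psi$), affixing ($\varphi'\to\varphi,\ \psi\to\psi'/(\varphi\to\psi)\to(\varphi'\to\psi')$), contraposition ($\varphi\to\psi/\neg\psi\to\neg\varphi$), $\Box$-monotonicity ($\varphi\to\psi/\Box\varphi\to\Box\psi$), $\Box_L$-monotonicity ($\varphi\to\psi/\Box_L\varphi\to\Box_L\psi$). The axiom system $\mathsf{CL}$ consists of: classical propositional logic (all substitution instances over the full language, $\neg,\to,\land,\lor$ read classically), modus ponens, uniform substitution; an axiom $\Box_L\varphi$ for each axiom $\varphi$ of $\mathsf{L}$; for each inference rule $\varphi_1,\dots,\varphi_n/\psi$ of $\mathsf{L}$, the rule $\Box_L\varphi_1,\dots,\Box_L\varphi_n/\Box_L\psi$; and the Bridge Rule: from $\Box_L(\varphi\to\psi)$ infer $\varphi\to\psi$. -}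

module Defs where

open import Data.Nat using (ℕ)
open import Data.Bool using (Bool; true; false; not; _∧_; _∨_)
open import Relation.Binary.PropositionalEquality using (_≡_)

infixr 5 _⇒_
infixr 6 _∨̇_
infixr 7 _∧̇_
infix 4 _⇔_
infix 9 ¬̇_ □_ □L_
data Fm : Set where
  var  : ℕ → Fm
  _∧̇_ : Fm → Fm → Fm
  _∨̇_ : Fm → Fm → Fm
  _⇒_  : Fm → Fm → Fm
  ¬̇_   : Fm → Fm
  □_   : Fm → Fm
  □L_  : Fm → Fm

_⇔_ : Fm → Fm → Fm
φ ⇔ ψ = (φ ⇒ ψ) ∧̇ (ψ ⇒ φ)

Subst : Set
Subst = ℕ → Fm

_[_] : Fm → Subst → Fm
var n [ σ ] = σ n
(φ ∧̇ ψ) [ σ ] = (φ [ σ ]) ∧̇ (ψ [ σ ])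
(φ ∨̇ ψ) [ σ ] = (φ [ σ ]) ∨̇ (ψ [ σ ])
(φ ⇒ ψ) [ σ ] = (φ [ σ ]) ⇒ (ψ [ σ ])
(¬̇ φ) [ σ ] = ¬̇ (φ [ σ ])
(□ φ) [ σ ] = □ (φ [ σ ])
(□L φ) [ σ ] = □L (φ [ σ ])

p q r : Fm
p = var 0
q = var 1
r = var 2

data Cond : Set where
  DN Cp WB X Rd B CB W C M ER Nec □K □T □D □4 □5 : Cond

data BaseAx : Fm → Set where
  a1  : BaseAx (p ⇒ p)
  a2  : BaseAx (¬̇ (p ∧̇ q) ⇒ (¬̇ p ∨̇ ¬̇ q))
  a3  : BaseAx ((¬̇ p ∧̇ ¬̇ q) ⇒ ¬̇ (p ∨̇ q))
  a4  : BaseAx ((p ∧̇ q) ⇒ p)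
  a5  : BaseAx ((p ∧̇ q) ⇒ q)
  a6  : BaseAx (p ⇒ (p ∨̇ q))
  a7  : BaseAx (q ⇒ (p ∨̇ q))
  a8  : BaseAx (((p ⇒ q) ∧̇ (p ⇒ r)) ⇒ (p ⇒ (q ∧̇ r)))
  a9  : BaseAx (((p ⇒ r) ∧̇ (q ⇒ r)) ⇒ ((p ∨̇ q) ⇒ r))
  a10 : BaseAx ((p ∧̇ (q ∨̇ r)) ⇒ ((p ∧̇ q) ∨̇ (p ∧̇ r)))
  a11 : BaseAx ((□ p ∧̇ □ q) ⇒ □ (p ∧̇ q))
  a12 : BaseAx ((□L p ∧̇ □L q) ⇒ □L (p ∧̇ q))

-- Axioms corresponding to frame conditions ((ER) and (Nec) correspond to rules).
data CondAx : Cond → Fm → Set where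
  ax-DN : CondAx DN (p ⇔ ¬̇ ¬̇ p)
  ax-Cp : CondAx Cp ((p ⇒ q) ⇒ (¬̇ q ⇒ ¬̇ p))
  ax-WB : CondAx WB (((p ⇒ q) ∧̇ (q ⇒ r)) ⇒ (p ⇒ r))
  ax-X  : CondAx X (p ∨̇ ¬̇ p)
  ax-Rd : CondAx Rd ((p ⇒ ¬̇ p) ⇒ ¬̇ p)
  ax-B  : CondAx B ((p ⇒ q) ⇒ ((r ⇒ p) ⇒ (r ⇒ q)))
  ax-CB : CondAx CB ((p ⇒ q) ⇒ ((q ⇒ r) ⇒ (p ⇒ r)))
  ax-W  : CondAx W ((p ⇒ (p ⇒ q)) ⇒ (p ⇒ q))
  ax-C  : CondAx C ((p ⇒ (q ⇒ r)) ⇒ (q ⇒ (p ⇒ r)))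
  ax-M  : CondAx M (p ⇒ (p ⇒ p))
  ax-□K : CondAx □K (□ (p ⇒ q) ⇒ (□ p ⇒ □ q))
  ax-□T : CondAx □T (□ p ⇒ p)
  ax-□D : CondAx □D (□ (¬̇ p) ⇒ ¬̇ (□ p))
  ax-□4 : CondAx □4 (□ p ⇒ □ (□ p))
  ax-□5 : CondAx □5 (¬̇ (□ p) ⇒ □ (¬̇ (□ p)))

data LAx (Φ : Cond → Set) : Fm → Set where
  base : ∀ {φ} → BaseAx φ → LAx Φ φ
  cond : ∀ {c φ} → Φ c → CondAx c φ → LAx Φ φ

data _⊢L_ (Φ : Cond → Set) : Fm → Set where
  ax       : ∀ {φ} → LAx Φ φ → Φ ⊢L φ
  usub     : ∀ {φ} (σ : Subst) → Φ ⊢L φ → Φ ⊢L (φ [ σ ])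
  mp       : ∀ {φ ψ} → Φ ⊢L φ → Φ ⊢L (φ ⇒ ψ) → Φ ⊢L ψ
  adj      : ∀ {φ ψ} → Φ ⊢L φ → Φ ⊢L ψ → Φ ⊢L (φ ∧̇ ψ)
  affix    : ∀ {φ φ' ψ ψ'} → Φ ⊢L (φ' ⇒ φ) → Φ ⊢L (ψ ⇒ ψ') →
             Φ ⊢L ((φ ⇒ ψ) ⇒ (φ' ⇒ ψ'))
  contrap  : ∀ {φ ψ} → Φ ⊢L (φ ⇒ ψ) → Φ ⊢L (¬̇ ψ ⇒ ¬̇ φ)
  □mono    : ∀ {φ ψ} → Φ ⊢L (φ ⇒ ψ) → Φ ⊢L (□ φ ⇒ □ ψ)
  □Lmono   : ∀ {φ ψ} → Φ ⊢L (φ ⇒ ψ) → Φ ⊢L (□L φ ⇒ □L ψ)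
  er       : ∀ {φ} (ψ : Fm) → Φ ER → Φ ⊢L φ → Φ ⊢L ((φ ⇒ ψ) ⇒ ψ)
  nec      : ∀ {φ} → Φ Nec → Φ ⊢L φ → Φ ⊢L (□ φ)

-- Classical (Boolean) evaluation of the full language: ¬,⇒,∧,∨ read
-- classically, formulas □ φ and □L φ treated as atoms (valued by b, bL).
⟦_⟧ : Fm → (ℕ → Bool) → (Fm → Bool) → (Fm → Bool) → Bool
⟦ var n ⟧ v b bL = v n
⟦ φ ∧̇ ψ ⟧ v b bL = ⟦ φ ⟧ v b bL ∧ ⟦ ψ ⟧ v b bL
⟦ φ ∨̇ ψ ⟧ v b bL = ⟦ φ ⟧ v b bL ∨ ⟦ ψ ⟧ v b bL
⟦ φ ⇒ ψ ⟧ v b bL = not (⟦ φ ⟧ v b bL) ∨ ⟦ ψ ⟧ v b bL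
⟦ ¬̇ φ ⟧ v b bL = not (⟦ φ ⟧ v b bL)
⟦ □ φ ⟧ v b bL = b φ
⟦ □L φ ⟧ v b bL = bL φ

-- substitution instances (over the full language) of classical tautologies
Taut : Fm → Set
Taut φ = ∀ v b bL → ⟦ φ ⟧ v b bL ≡ true

data _⊢CL_ (Φ : Cond → Set) : Fm → Set where
  taut     : ∀ {φ} → Taut φ → Φ ⊢CL φ
  mp       : ∀ {φ ψ} → Φ ⊢CL φ → Φ ⊢CL (φ ⇒ ψ) → Φ ⊢CL ψ
  usub     : ∀ {φ} (σ : Subst) → Φ ⊢CL φ → Φ ⊢CL (φ [ σ ])
  □Lax     : ∀ {φ} → LAx Φ φ → Φ ⊢CL (□L φ)
  b-usub   : ∀ {φ} (σ : Subst) → Φ ⊢CL (□L φ) → Φ ⊢CL (□L (φ [ σ ]))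
  b-mp     : ∀ {φ ψ} → Φ ⊢CL (□L φ) → Φ ⊢CL (□L (φ ⇒ ψ)) → Φ ⊢CL (□L ψ)
  b-adj    : ∀ {φ ψ} → Φ ⊢CL (□L φ) → Φ ⊢CL (□L ψ) → Φ ⊢CL (□L (φ ∧̇ ψ))
  b-affix  : ∀ {φ φ' ψ ψ'} → Φ ⊢CL (□L (φ' ⇒ φ)) → Φ ⊢CL (□L (ψ ⇒ ψ')) →
             Φ ⊢CL (□L ((φ ⇒ ψ) ⇒ (φ' ⇒ ψ')))
  b-contrap : ∀ {φ ψ} → Φ ⊢CL (□L (φ ⇒ ψ)) → Φ ⊢CL (□L (¬̇ ψ ⇒ ¬̇ φ))
  b-□mono  : ∀ {φ ψ} → Φ ⊢CL (□L (φ ⇒ ψ)) → Φ ⊢CL (□L (□ φ ⇒ □ ψ))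
  b-□Lmono : ∀ {φ ψ} → Φ ⊢CL (□L (φ ⇒ ψ)) → Φ ⊢CL (□L (□L φ ⇒ □L ψ))
  b-er     : ∀ {φ} (ψ : Fm) → Φ ER → Φ ⊢CL (□L φ) → Φ ⊢CL (□L ((φ ⇒ ψ) ⇒ ψ))
  b-nec    : ∀ {φ} → Φ Nec → Φ ⊢CL (□L φ) → Φ ⊢CL (□L (□ φ))
  bridge   : ∀ {φ ψ} → Φ ⊢CL (□L (φ ⇒ ψ)) → Φ ⊢CL (φ ⇒ ψ)

-- Read □L χ at level 0 as itself and at level j + 1 as "χ and □L χ", with χ
-- read at level j inside. Every rule of CL is sound for each of these
-- readings: the boxed rules of CL act on the □L-conjunct, their unboxed
-- counterparts on the other one (for implications this is the Bridge rule),
-- and the Bridge rule itself is justified by the first conjunct one level up.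
-- Nec is the one rule without an unboxed counterpart, since CL proves no □ φ
-- outright. Since level 0 is the identity, reading a CL-proof of □L φ at
-- level 1 yields a CL-proof of φ.
module Submission where

open import Defs
open import Data.Bool using (true; false; not; _∧_; _∨_)
open import Data.Bool.Properties using (∨-inverseʳ)
open import Data.Empty using (⊥-elim)
open import Data.Nat using (ℕ; zero; suc)
open import Data.Product using (_×_; _,_)
open import Function using (_∘_)
open import Relation.Binary.PropositionalEquality using (_≡_; refl; sym; trans; cong; cong₂; subst)
open import Relation.Nullary using (¬_)

private
  variable
    φ ψ : Fm

_⨾_ : Subst → Subst → Subst
(σ ⨾ τ) n = σ n [ τ ]

[]-assoc : ∀ φ σ τ → (φ [ σ ]) [ τ ] ≡ φ [ σ ⨾ τ ]
[]-assoc (var n) σ τ = refl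
[]-assoc (φ ∧̇ ψ) σ τ = cong₂ _∧̇_ ([]-assoc φ σ τ) ([]-assoc ψ σ τ)
[]-assoc (φ ∨̇ ψ) σ τ = cong₂ _∨̇_ ([]-assoc φ σ τ) ([]-assoc ψ σ τ)
[]-assoc (φ ⇒ ψ) σ τ = cong₂ _⇒_ ([]-assoc φ σ τ) ([]-assoc ψ σ τ)
[]-assoc (¬̇ φ) σ τ = cong ¬̇_ ([]-assoc φ σ τ)
[]-assoc (□ φ) σ τ = cong □_ ([]-assoc φ σ τ)
[]-assoc (□L φ) σ τ = cong □L_ ([]-assoc φ σ τ)

[]-identity : ∀ φ → φ [ var ] ≡ φ
[]-identity (var n) = refl
[]-identity (φ ∧̇ ψ) = cong₂ _∧̇_ ([]-identity φ) ([]-identity ψ)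
[]-identity (φ ∨̇ ψ) = cong₂ _∨̇_ ([]-identity φ) ([]-identity ψ)
[]-identity (φ ⇒ ψ) = cong₂ _⇒_ ([]-identity φ) ([]-identity ψ)
[]-identity (¬̇ φ) = cong ¬̇_ ([]-identity φ)
[]-identity (□ φ) = cong □_ ([]-identity φ)
[]-identity (□L φ) = cong □L_ ([]-identity φ)

sub₃ : Fm → Fm → Fm → Subst
sub₃ α β γ 0 = α
sub₃ α β γ 1 = β
sub₃ α β γ 2 = γ
sub₃ α β γ (suc (suc (suc n))) = var n

replace□L : (Fm → Fm) → Fm → Fm
replace□L f (var n) = var n
replace□L f (φ ∧̇ ψ) = replace□L f φ ∧̇ replace□L f ψ
replace□L f (φ ∨̇ ψ) = replace□L f φ ∨̇ replace□L f ψ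
replace□L f (φ ⇒ ψ) = replace□L f φ ⇒ replace□L f ψ
replace□L f (¬̇ φ) = ¬̇ replace□L f φ
replace□L f (□ φ) = □ replace□L f φ
replace□L f (□L φ) = f φ

replace□L-□L : ∀ φ → replace□L □L_ φ ≡ φ
replace□L-□L (var n) = refl
replace□L-□L (φ ∧̇ ψ) = cong₂ _∧̇_ (replace□L-□L φ) (replace□L-□L ψ)
replace□L-□L (φ ∨̇ ψ) = cong₂ _∨̇_ (replace□L-□L φ) (replace□L-□L ψ)
replace□L-□L (φ ⇒ ψ) = cong₂ _⇒_ (replace□L-□L φ) (replace□L-□L ψ)
replace□L-□L (¬̇ φ) = cong ¬̇_ (replace□L-□L φ)
replace□L-□L (□ φ) = cong □_ (replace□L-□L φ)
replace□L-□L (□L φ) = refl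

⟦[]⟧ : ∀ φ σ v b bL → ⟦ φ [ σ ] ⟧ v b bL ≡
  ⟦ φ ⟧ (λ n → ⟦ σ n ⟧ v b bL) (λ χ → b (χ [ σ ])) (λ χ → bL (χ [ σ ]))
⟦[]⟧ (var n) σ v b bL = refl
⟦[]⟧ (φ ∧̇ ψ) σ v b bL = cong₂ _∧_ (⟦[]⟧ φ σ v b bL) (⟦[]⟧ ψ σ v b bL)
⟦[]⟧ (φ ∨̇ ψ) σ v b bL = cong₂ _∨_ (⟦[]⟧ φ σ v b bL) (⟦[]⟧ ψ σ v b bL)
⟦[]⟧ (φ ⇒ ψ) σ v b bL = cong₂ (λ x y → not x ∨ y) (⟦[]⟧ φ σ v b bL) (⟦[]⟧ ψ σ v b bL)
⟦[]⟧ (¬̇ φ) σ v b bL = cong not (⟦[]⟧ φ σ v b bL)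
⟦[]⟧ (□ φ) σ v b bL = refl
⟦[]⟧ (□L φ) σ v b bL = refl

⟦replace□L⟧ : ∀ f φ v b bL → ⟦ replace□L f φ ⟧ v b bL ≡
  ⟦ φ ⟧ v (λ χ → b (replace□L f χ)) (λ χ → ⟦ f χ ⟧ v b bL)
⟦replace□L⟧ f (var n) v b bL = refl
⟦replace□L⟧ f (φ ∧̇ ψ) v b bL = cong₂ _∧_ (⟦replace□L⟧ f φ v b bL) (⟦replace□L⟧ f ψ v b bL)
⟦replace□L⟧ f (φ ∨̇ ψ) v b bL = cong₂ _∨_ (⟦replace□L⟧ f φ v b bL) (⟦replace□L⟧ f ψ v b bL)
⟦replace□L⟧ f (φ ⇒ ψ) v b bL =
  cong₂ (λ x y → not x ∨ y) (⟦replace□L⟧ f φ v b bL) (⟦replace□L⟧ f ψ v b bL)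
⟦replace□L⟧ f (¬̇ φ) v b bL = cong not (⟦replace□L⟧ f φ v b bL)
⟦replace□L⟧ f (□ φ) v b bL = refl
⟦replace□L⟧ f (□L φ) v b bL = refl

Taut-[] : ∀ φ σ → Taut φ → Taut (φ [ σ ])
Taut-[] φ σ t v b bL = trans (⟦[]⟧ φ σ v b bL) (t _ _ _)

Taut-replace□L : ∀ f φ → Taut φ → Taut (replace□L f φ)
Taut-replace□L f φ t v b bL = trans (⟦replace□L⟧ f φ v b bL) (t _ _ _)

DN-taut : Taut (p ⇔ ¬̇ ¬̇ p)
DN-taut v _ _ with v 0
... | true = refl
... | false = refl

X-taut : Taut (p ∨̇ ¬̇ p)
X-taut v _ _ = ∨-inverseʳ (v 0)

∧-intro-taut : ∀ α β → Taut (α ⇒ β ⇒ α ∧̇ β)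
∧-intro-taut α β v b bL = lemma (⟦ α ⟧ v b bL) (⟦ β ⟧ v b bL)
  where
    lemma : ∀ x y → not x ∨ (not y ∨ (x ∧ y)) ≡ true
    lemma true true = refl
    lemma true false = refl
    lemma false _ = refl

∧-elimˡ-taut : ∀ α β → Taut (α ∧̇ β ⇒ α)
∧-elimˡ-taut α β v b bL = lemma (⟦ α ⟧ v b bL) (⟦ β ⟧ v b bL)
  where
    lemma : ∀ x y → not (x ∧ y) ∨ x ≡ true
    lemma true true = refl
    lemma true false = refl
    lemma false _ = refl

∧-elimʳ-taut : ∀ α β → Taut (α ∧̇ β ⇒ β)
∧-elimʳ-taut α β v b bL = lemma (⟦ α ⟧ v b bL) (⟦ β ⟧ v b bL)
  where
    lemma : ∀ x y → not (x ∧ y) ∨ y ≡ true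
    lemma true true = refl
    lemma true false = refl
    lemma false _ = refl

mutual
  unfold : ℕ → Fm → Fm
  unfold j = replace□L (unfold□L j)

  unfold□L : ℕ → Fm → Fm
  unfold□L zero φ = □L φ
  unfold□L (suc j) φ = unfold j φ ∧̇ □L unfold j φ

unfold-zero : ∀ φ → unfold zero φ ≡ φ
unfold-zero = replace□L-□L

module _ {Φ : Cond → Set} where

  ∧-intro : ∀ {α β} → Φ ⊢CL α → Φ ⊢CL β → Φ ⊢CL (α ∧̇ β)
  ∧-intro {α} {β} a b = mp b (mp a (taut (∧-intro-taut α β)))

  ∧-elimˡ : ∀ {α β} → Φ ⊢CL (α ∧̇ β) → Φ ⊢CL α
  ∧-elimˡ {α} {β} d = mp d (taut (∧-elimˡ-taut α β))

  ∧-elimʳ : ∀ {α β} → Φ ⊢CL (α ∧̇ β) → Φ ⊢CL β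
  ∧-elimʳ {α} {β} d = mp d (taut (∧-elimʳ-taut α β))

  with-bridge : ∀ {α β} → Φ ⊢CL (□L (α ⇒ β)) → Φ ⊢CL ((α ⇒ β) ∧̇ □L (α ⇒ β))
  with-bridge d = ∧-intro (bridge d) d

  infix 3 _⟶_
  _⟶_ : Fm → Fm → Set
  α ⟶ β = Φ ⊢CL (□L (α ⇒ β))

  ⟶-refl : ∀ α → α ⟶ α
  ⟶-refl α = usub (sub₃ α α α) (□Lax (base a1))

  ⟶-trans : ∀ {α β γ} → α ⟶ β → β ⟶ γ → α ⟶ γ
  ⟶-trans {β = β} f g = b-mp (⟶-refl β) (b-affix f g)

  π₁ : ∀ α β → α ∧̇ β ⟶ α
  π₁ α β = usub (sub₃ α β α) (□Lax (base a4))

  π₂ : ∀ α β → α ∧̇ β ⟶ β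
  π₂ α β = usub (sub₃ α β α) (□Lax (base a5))

  ⟨_,_⟩ : ∀ {α β γ} → α ⟶ β → α ⟶ γ → α ⟶ β ∧̇ γ
  ⟨_,_⟩ {α} {β} {γ} f g = b-mp (b-adj f g) (usub (sub₃ α β γ) (□Lax (base a8)))

  ∧-map : ∀ {α β γ δ} → α ⟶ β → γ ⟶ δ → α ∧̇ γ ⟶ β ∧̇ δ
  ∧-map {α} {γ = γ} f g = ⟨ ⟶-trans (π₁ α γ) f , ⟶-trans (π₂ α γ) g ⟩

  □L-∧ : ∀ α β → □L α ∧̇ □L β ⟶ □L (α ∧̇ β)
  □L-∧ α β = usub (sub₃ α β α) (□Lax (base a12))

  unfold□L-∧ : ∀ j α β → unfold□L j α ∧̇ unfold□L j β ⟶ unfold□L j (α ∧̇ β)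
  unfold□L-∧ zero α β = □L-∧ α β
  unfold□L-∧ (suc j) α β =
    ⟨ ∧-map (π₁ α′ (□L α′)) (π₁ β′ (□L β′))
    , ⟶-trans (∧-map (π₂ α′ (□L α′)) (π₂ β′ (□L β′))) (□L-∧ α′ β′) ⟩
    where
      α′ = unfold j α
      β′ = unfold j β

  unfold□L-mono : ∀ {α β} → α ⟶ β → (∀ j → unfold j α ⟶ unfold j β) →
    ∀ j → unfold□L j α ⟶ unfold□L j β
  unfold□L-mono f g zero = b-□Lmono f
  unfold□L-mono f g (suc j) = ∧-map (g j) (b-□Lmono (g j))

  □L-free-implication : LAx Φ (φ ⇒ ψ) → ∀ τ → Φ ⊢CL (((φ ⇒ ψ) [ τ ]) ∧̇ □L ((φ ⇒ ψ) [ τ ]))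
  □L-free-implication a τ = with-bridge (usub τ (□Lax a))

  tautological-axiom : Taut φ → LAx Φ φ → ∀ τ → Φ ⊢CL ((φ [ τ ]) ∧̇ □L (φ [ τ ]))
  tautological-axiom {φ} t a τ = ∧-intro (taut (Taut-[] φ τ t)) (usub τ (□Lax a))

  -- Every axiom except a12 is □L-free, so each clause below holds because
  -- unfolding an instance of such an axiom is, definitionally, another instance.
  axiom-unfold : LAx Φ φ → ∀ j σ →
    Φ ⊢CL (unfold j (φ [ σ ]) ∧̇ □L unfold j (φ [ σ ]))
  axiom-unfold (base a12) j σ = with-bridge (unfold□L-∧ j (σ 0) (σ 1))
  axiom-unfold a@(cond _ ax-DN) j σ = tautological-axiom DN-taut a (unfold j ∘ σ)
  axiom-unfold a@(cond _ ax-X) j σ = tautological-axiom X-taut a (unfold j ∘ σ)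
  axiom-unfold a@(base a1) j σ = □L-free-implication a (unfold j ∘ σ)
  axiom-unfold a@(base a2) j σ = □L-free-implication a (unfold j ∘ σ)
  axiom-unfold a@(base a3) j σ = □L-free-implication a (unfold j ∘ σ)
  axiom-unfold a@(base a4) j σ = □L-free-implication a (unfold j ∘ σ)
  axiom-unfold a@(base a5) j σ = □L-free-implication a (unfold j ∘ σ)
  axiom-unfold a@(base a6) j σ = □L-free-implication a (unfold j ∘ σ)
  axiom-unfold a@(base a7) j σ = □L-free-implication a (unfold j ∘ σ)
  axiom-unfold a@(base a8) j σ = □L-free-implication a (unfold j ∘ σ)
  axiom-unfold a@(base a9) j σ = □L-free-implication a (unfold j ∘ σ)
  axiom-unfold a@(base a10) j σ = □L-free-implication a (unfold j ∘ σ)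
  axiom-unfold a@(base a11) j σ = □L-free-implication a (unfold j ∘ σ)
  axiom-unfold a@(cond _ ax-Cp) j σ = □L-free-implication a (unfold j ∘ σ)
  axiom-unfold a@(cond _ ax-WB) j σ = □L-free-implication a (unfold j ∘ σ)
  axiom-unfold a@(cond _ ax-Rd) j σ = □L-free-implication a (unfold j ∘ σ)
  axiom-unfold a@(cond _ ax-B) j σ = □L-free-implication a (unfold j ∘ σ)
  axiom-unfold a@(cond _ ax-CB) j σ = □L-free-implication a (unfold j ∘ σ)
  axiom-unfold a@(cond _ ax-W) j σ = □L-free-implication a (unfold j ∘ σ)
  axiom-unfold a@(cond _ ax-C) j σ = □L-free-implication a (unfold j ∘ σ)
  axiom-unfold a@(cond _ ax-M) j σ = □L-free-implication a (unfold j ∘ σ)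
  axiom-unfold a@(cond _ ax-□K) j σ = □L-free-implication a (unfold j ∘ σ)
  axiom-unfold a@(cond _ ax-□T) j σ = □L-free-implication a (unfold j ∘ σ)
  axiom-unfold a@(cond _ ax-□D) j σ = □L-free-implication a (unfold j ∘ σ)
  axiom-unfold a@(cond _ ax-□4) j σ = □L-free-implication a (unfold j ∘ σ)
  axiom-unfold a@(cond _ ax-□5) j σ = □L-free-implication a (unfold j ∘ σ)

module _ {Φ : Cond → Set} (no-nec : ¬ Φ Nec) where

  ⊢L⇒⊢CL-□L : Φ ⊢L φ → Φ ⊢CL (□L φ)
  ⊢L⇒⊢CL-□L (ax a) = □Lax a
  ⊢L⇒⊢CL-□L (usub σ d) = b-usub σ (⊢L⇒⊢CL-□L d)
  ⊢L⇒⊢CL-□L (mp d e) = b-mp (⊢L⇒⊢CL-□L d) (⊢L⇒⊢CL-□L e)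
  ⊢L⇒⊢CL-□L (adj d e) = b-adj (⊢L⇒⊢CL-□L d) (⊢L⇒⊢CL-□L e)
  ⊢L⇒⊢CL-□L (affix d e) = b-affix (⊢L⇒⊢CL-□L d) (⊢L⇒⊢CL-□L e)
  ⊢L⇒⊢CL-□L (contrap d) = b-contrap (⊢L⇒⊢CL-□L d)
  ⊢L⇒⊢CL-□L (□mono d) = b-□mono (⊢L⇒⊢CL-□L d)
  ⊢L⇒⊢CL-□L (□Lmono d) = b-□Lmono (⊢L⇒⊢CL-□L d)
  ⊢L⇒⊢CL-□L (er ψ e d) = b-er ψ e (⊢L⇒⊢CL-□L d)
  ⊢L⇒⊢CL-□L (nec n d) = ⊥-elim (no-nec n)

  -- The substitution σ is carried along because unfolding does not commute
  -- with substitution.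
  mutual
    ⊢CL-unfold : Φ ⊢CL ψ → ∀ j σ → Φ ⊢CL unfold j (ψ [ σ ])
    ⊢CL-unfold {ψ} (taut t) j σ = taut (Taut-replace□L (unfold□L j) (ψ [ σ ]) (Taut-[] ψ σ t))
    ⊢CL-unfold (mp d e) j σ = mp (⊢CL-unfold d j σ) (⊢CL-unfold e j σ)
    ⊢CL-unfold (usub {φ} σ′ d) j σ =
      subst (λ χ → Φ ⊢CL unfold j χ) (sym ([]-assoc φ σ′ σ)) (⊢CL-unfold d j (σ′ ⨾ σ))
    ⊢CL-unfold (b-usub {φ} σ′ d) j σ =
      subst (λ χ → Φ ⊢CL unfold j χ) (sym ([]-assoc (□L φ) σ′ σ)) (⊢CL-unfold d j (σ′ ⨾ σ))
    ⊢CL-unfold (bridge d) j σ = unfolded d j σ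
    ⊢CL-unfold (b-nec n d) j σ = ⊥-elim (no-nec n)
    ⊢CL-unfold (□Lax a) zero σ = usub σ (□Lax a)
    ⊢CL-unfold (□Lax a) (suc j) σ = axiom-unfold a j σ
    ⊢CL-unfold (b-mp d e) zero σ = b-mp (⊢CL-unfold d zero σ) (⊢CL-unfold e zero σ)
    ⊢CL-unfold (b-mp d e) (suc j) σ =
      ∧-intro (mp (unfolded d j σ) (unfolded e j σ)) (b-mp (unfolded-□L d j σ) (unfolded-□L e j σ))
    ⊢CL-unfold (b-adj d e) zero σ = b-adj (⊢CL-unfold d zero σ) (⊢CL-unfold e zero σ)
    ⊢CL-unfold (b-adj d e) (suc j) σ =
      ∧-intro (∧-intro (unfolded d j σ) (unfolded e j σ)) (b-adj (unfolded-□L d j σ) (unfolded-□L e j σ))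
    ⊢CL-unfold (b-affix d e) zero σ = b-affix (⊢CL-unfold d zero σ) (⊢CL-unfold e zero σ)
    ⊢CL-unfold (b-affix d e) (suc j) σ = with-bridge (b-affix (unfolded-□L d j σ) (unfolded-□L e j σ))
    ⊢CL-unfold (b-contrap d) zero σ = b-contrap (⊢CL-unfold d zero σ)
    ⊢CL-unfold (b-contrap d) (suc j) σ = with-bridge (b-contrap (unfolded-□L d j σ))
    ⊢CL-unfold (b-□mono d) zero σ = b-□mono (⊢CL-unfold d zero σ)
    ⊢CL-unfold (b-□mono d) (suc j) σ = with-bridge (b-□mono (unfolded-□L d j σ))
    ⊢CL-unfold (b-□Lmono d) zero σ = b-□Lmono (⊢CL-unfold d zero σ)
    ⊢CL-unfold (b-□Lmono d) (suc j) σ =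
      with-bridge (unfold□L-mono (⊢CL-unfold d zero σ) (λ k → unfolded-□L d k σ) j)
    ⊢CL-unfold (b-er ψ e d) zero σ = b-er (ψ [ σ ]) e (⊢CL-unfold d zero σ)
    ⊢CL-unfold (b-er ψ e d) (suc j) σ = with-bridge (b-er (unfold j (ψ [ σ ])) e (unfolded-□L d j σ))

    unfolded : Φ ⊢CL (□L φ) → ∀ j σ → Φ ⊢CL unfold j (φ [ σ ])
    unfolded d j σ = ∧-elimˡ (⊢CL-unfold d (suc j) σ)

    unfolded-□L : Φ ⊢CL (□L φ) → ∀ j σ → Φ ⊢CL (□L unfold j (φ [ σ ]))
    unfolded-□L d j σ = ∧-elimʳ (⊢CL-unfold d (suc j) σ)

  □L-elim : Φ ⊢CL (□L φ) → Φ ⊢CL φ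
  □L-elim {φ} d =
    subst (Φ ⊢CL_) (trans (unfold-zero (φ [ var ])) ([]-identity φ)) (unfolded d zero var)

proposition5p4 : (Φ : Cond → Set) → ¬ Φ Nec → (φ : Fm) →
    (Φ ⊢L φ → Φ ⊢CL φ) × (Φ ⊢CL (□L φ) → Φ ⊢CL φ)
proposition5p4 Φ no-nec φ = □L-elim no-nec ∘ ⊢L⇒⊢CL-□L no-nec , □L-elim no-nec
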